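{- Let $\Gamma_1$ and $\Gamma_2$ be two left-to-right equivalent straight-line level planar drawings of the same hierarchical plane graph $(G,\vec d,L,\gamma)$. Then the linear morph $\langle\Gamma_1,\Gamma_2\rangle$ transforming $\Gamma_1$ into $\Gamma_2$ is planar and unidirectional.
   Context: A hierarchical graph is a tuple $(G,\vec d,L,\gamma)$ where $G$ is a graph, $\vec d$ is an oriented straight line, $L$ is a set of parallel lines orthogonal to $\vec d$ ordered as they are met when traversing $\vec d$, and $\gamma$ maps each vertex of $G$ to a line of $L$ so that $\gamma(u)\neq\gamma(v)$ for every edge $(u,v)$. A (straight-line) level drawing places each vertex $v$ on the line $\gamma(v)$ and draws each edge $(u,v)$ with $\gamma(u)$ preceding $\gamma(v)$ as a straight segment $\vec{uv}$ monotone with respect to $\vec d$ (its projection on $\vec d$ strictly increases from $u$ to $v$); it is level planar if it is planar. A hierarchical plane graph is a hierarchical graph whose $G$ is a plane graph admitting a level planar drawing respecting the embedding of $G$. Orient each line $l\in L$ so that $\vec d$ crosses $l$ from the right of $l$ to its left. In a level drawing, an edge $e$ precedes (follows) a vertex $v$ on $l$ if $\gamma(v)=l$, $e$ crosses $l$ at a point $p_l(e)$, and $p_l(e)$ precedes (follows) $v$ along $l$; an edge $e$ precedes (follows) an edge $e'$ on $l$ if both cross $l$ and the crossing point of $e$ precedes (follows) that of $e'$ along $l$; similarly for two vertices on $l$. Two level drawings $\Gamma_1,\Gamma_2$ are left-to-right equivalent if for every line $l\in L$ and all vertices/edges $x,y$ of $G$, $x$ precedes (follows) $y$ on $l$ in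 $\Gamma_1$ if and only if $x$ precedes (follows) $y$ on $l$ in $\Gamma_2$. A linear morph moves each vertex at constant speed along a straight segment from its position in $\Gamma_1$ to that in $\Gamma_2$; it is planar if the drawing is planar at every time, and unidirectional if all vertex trajectories are parallel. -}

module Defs where

open import Level using (0ℓ)
open import Data.Nat using (ℕ)
open import Data.Fin using (Fin) renaming (_<_ to _<ᶠ_)
open import Data.Product using (Σ; ∃; ∃-syntax; _×_; _,_; proj₁; proj₂)
open import Data.Sum using (_⊎_; inj₁; inj₂)
open import Data.Empty using (⊥)
open import Relation.Nullary using (¬_)
open import Relation.Binary.PropositionalEquality using (_≡_; _≢_)

-- The real numbers, axiomatised as a (Dedekind-)complete ordered field.
-- Any model of this record is isomorphic to ℝ.

record RealField : Set₁ where
  infixl 6 _+_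
  infixl 7 _*_
  infix 4 _<_ _≤_
  field
    Carrier : Set
    0# 1#   : Carrier
    _+_ _*_ : Carrier → Carrier → Carrier
    -_      : Carrier → Carrier
    _<_     : Carrier → Carrier → Set
    +-assoc : ∀ x y z → (x + y) + z ≡ x + (y + z)
    +-comm  : ∀ x y → x + y ≡ y + x
    +-idˡ   : ∀ x → 0# + x ≡ x
    -‿invˡ  : ∀ x → (- x) + x ≡ 0#
    *-assoc : ∀ x y z → (x * y) * z ≡ x * (y * z)
    *-comm  : ∀ x y → x * y ≡ y * x
    *-idˡ   : ∀ x → 1# * x ≡ x
    distribˡ : ∀ x y z → x * (y + z) ≡ x * y + x * z
    0≢1     : 0# ≢ 1#
    inverse : ∀ x → x ≢ 0# → Σ Carrier (λ y → x * y ≡ 1#)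
    <-irrefl : ∀ x → ¬ (x < x)
    <-trans  : ∀ x y z → x < y → y < z → x < z
    <-tri    : ∀ x y → x < y ⊎ (x ≡ y ⊎ y < x)
    +-mono-< : ∀ x y z → x < y → x + z < y + z
    *-pos    : ∀ x y → 0# < x → 0# < y → 0# < x * y

  _≤_ : Carrier → Carrier → Set
  x ≤ y = x < y ⊎ x ≡ y

  _-_ : Carrier → Carrier → Carrier
  x - y = x + (- y)

  field
    complete : (P : Carrier → Set) → Σ Carrier P →
               Σ Carrier (λ b → ∀ x → P x → x ≤ b) →
               Σ Carrier (λ s → (∀ x → P x → x ≤ s) ×
                                (∀ b → (∀ x → P x → x ≤ b) → s ≤ b))

module _ (ℝ : RealField) where
  open RealField ℝ

  Point : Set
  Point = Carrier × Carrier

  _⊕_ : Point → Point → Point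
  (a , b) ⊕ (c , d) = (a + c , b + d)

  _⊖_ : Point → Point → Point
  (a , b) ⊖ (c , d) = (a - c , b - d)

  _⊗_ : Carrier → Point → Point
  t ⊗ (a , b) = (t * a , t * b)

  dot : Point → Point → Carrier
  dot (a , b) (c , d) = a * c + b * d

  origin : Point
  origin = (0# , 0#)

  OnSeg : Point → Point → Point → Set
  OnSeg a b p = Σ Carrier (λ t → 0# ≤ t × t ≤ 1# × p ≡ a ⊕ (t ⊗ (b ⊖ a)))

  -- The oriented line d⃗ is given by a nonzero direction vector dir;
  -- the lines of L are Fin k, line i being { p | dot p dir ≡ lev i },
  -- orthogonal to d⃗; lev strictly increasing = ordered as met along d⃗.
  record HierGraph : Set where
    field
      n m k : ℕ
      end₁ end₂ : Fin m → Fin n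
      dir    : Point
      dir≢0  : dir ≢ origin
      lev    : Fin k → Carrier
      lev-<  : ∀ i j → i <ᶠ j → lev i < lev j
      γ      : Fin n → Fin k
      γ-edge : ∀ e → γ (end₁ e) ≢ γ (end₂ e)

  module _ (H : HierGraph) where
    open HierGraph H

    -- orientation of every line of L: d⃗ crosses it from right to left,
    -- i.e. the line direction is dir rotated clockwise by 90°
    lineDir : Point
    lineDir = (proj₂ dir , - proj₁ dir)

    Positions : Set
    Positions = Fin n → Point

    -- level drawing: each vertex v lies on the line γ(v)
    -- (edges are straight segments; monotonicity then follows from γ)
    IsLevelDrawing : Positions → Set
    IsLevelDrawing pos = ∀ v → dot (pos v) dir ≡ lev (γ v)

    IsEndpoint : Fin n → Fin m → Set
    IsEndpoint w e = w ≡ end₁ e ⊎ w ≡ end₂ e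

    OnEdge : Positions → Fin m → Point → Set
    OnEdge pos e p = OnSeg (pos (end₁ e)) (pos (end₂ e)) p

    IsPlanar : Positions → Set
    IsPlanar pos =
      (∀ u v → pos u ≡ pos v → u ≡ v) ×
      (∀ e w → ¬ IsEndpoint w e → ¬ OnEdge pos e (pos w)) ×
      (∀ e e' → e ≢ e' → ∀ p → OnEdge pos e p → OnEdge pos e' p →
         Σ (Fin n) (λ w → IsEndpoint w e × IsEndpoint w e' × p ≡ pos w))

    IsLevelPlanarDrawing : Positions → Set
    IsLevelPlanarDrawing pos = IsLevelDrawing pos × IsPlanar pos

    Crosses : Fin m → Fin k → Set
    Crosses e l = (γ (end₁ e) <ᶠ l × l <ᶠ γ (end₂ e))
                ⊎ (γ (end₂ e) <ᶠ l × l <ᶠ γ (end₁ e))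

    Item : Set
    Item = Fin n ⊎ Fin m

    Meets : Positions → Fin k → Item → Point → Set
    Meets pos l (inj₁ v) p = γ v ≡ l × p ≡ pos v
    Meets pos l (inj₂ e) p = Crosses e l × OnEdge pos e p × dot p dir ≡ lev l

    -- x precedes y on l (x follows y on l iff y precedes x on l)
    Precedes : Positions → Fin k → Item → Item → Set
    Precedes pos l x y = Σ Point (λ p → Σ Point (λ q →
      Meets pos l x p × Meets pos l y q × dot p lineDir < dot q lineDir))

    LeftToRightEquivalent : Positions → Positions → Set
    LeftToRightEquivalent pos₁ pos₂ = ∀ l x y →
      (Precedes pos₁ l x y → Precedes pos₂ l x y) ×
      (Precedes pos₂ l x y → Precedes pos₁ l x y)

    morphAt : Positions → Positions → Carrier → Positions
    morphAt pos₁ pos₂ t v = ((1# - t) ⊗ pos₁ v) ⊕ (t ⊗ pos₂ v)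

    IsPlanarMorph : Positions → Positions → Set
    IsPlanarMorph pos₁ pos₂ =
      ∀ t → 0# ≤ t → t ≤ 1# → IsPlanar (morphAt pos₁ pos₂ t)

    IsUnidirectional : Positions → Positions → Set
    IsUnidirectional pos₁ pos₂ = Σ Point (λ w → w ≢ origin ×
      (∀ v → Σ Carrier (λ s → pos₂ v ⊖ pos₁ v ≡ s ⊗ w)))

-- Every vertex stays on its line, so the morph moves each vertex parallel to the
-- lines of L; this is unidirectionality. On a fixed line, the abscissa of every
-- vertex and edge crossing is affine in the morph parameter t, and Γ₁, Γ₂ order the
-- objects on each line alike, so the sign of the gap between two of them is the
-- same at t = 0, at t = 1 and hence for all t ∈ [0, 1]. Two objects therefore meet
-- at time t only where they already meet in Γ₁. For two edges meeting at height y,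
-- let [L₁, L₂] be the range of lines both of them span. If y is L₁ or L₂ the meeting
-- point is an object on a line and is a common endpoint by planarity of Γ₁.
-- Otherwise the gap between the edges is affine in the height, and whether it
-- vanishes strictly inside (L₁, L₂) depends only on its signs at L₁ and L₂, which
-- are those of Γ₁, where it cannot vanish there.

module Submission where

open import Defs
open import Level using (0ℓ)
open import Data.Nat as ℕ using (ℕ; suc)
open import Data.Product using (Σ; _×_; _,_; proj₁; proj₂)
open import Data.Sum using (_⊎_; inj₁; inj₂; swap; [_,_])
import Data.Sum
open import Function using (id)
open import Data.Empty using (⊥; ⊥-elim)
open import Data.Maybe using (Maybe; just; nothing)
open import Data.Fin using (Fin) renaming (_<_ to _<ᶠ_)
import Data.Fin.Properties as Fin
open import Relation.Binary.Definitions using (tri<; tri≈; tri>)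
open import Relation.Nullary using (¬_; yes; no)
open import Relation.Binary.PropositionalEquality hiding ([_])
open import Algebra.Bundles using (CommutativeRing; RawRing)
open import Algebra.Solver.Ring.AlmostCommutativeRing
  using (fromCommutativeRing; _-Raw-AlmostCommutative⟶_)

module RealFieldProperties (ℝ : RealField) where
  open RealField ℝ

  +-identityʳ : ∀ x → x + 0# ≡ x
  +-identityʳ x = trans (+-comm x 0#) (+-idˡ x)

  -‿inverseʳ : ∀ x → x + (- x) ≡ 0#
  -‿inverseʳ x = trans (+-comm x (- x)) (-‿invˡ x)

  *-identityʳ : ∀ x → x * 1# ≡ x
  *-identityʳ x = trans (*-comm x 1#) (*-idˡ x)

  distribʳ : ∀ x y z → (y + z) * x ≡ y * x + z * x
  distribʳ x y z = trans (*-comm (y + z) x)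
    (trans (distribˡ x y z) (cong₂ _+_ (*-comm x y) (*-comm x z)))

  commutativeRing : CommutativeRing 0ℓ 0ℓ
  commutativeRing = record
    { Carrier = Carrier ; _≈_ = _≡_ ; _+_ = _+_ ; _*_ = _*_ ; -_ = -_ ; 0# = 0# ; 1# = 1#
    ; isCommutativeRing = record
      { isRing = record
        { +-isAbelianGroup = record
          { isGroup = record
            { isMonoid = record
              { isSemigroup = record
                { isMagma = record { isEquivalence = isEquivalence ; ∙-cong = cong₂ _+_ }
                ; assoc = +-assoc }
              ; identity = +-idˡ , +-identityʳ }
            ; inverse = -‿invˡ , -‿inverseʳ
            ; ⁻¹-cong = cong (λ x → - x) }
          ; comm = +-comm }
        ; *-cong = cong₂ _*_
        ; *-assoc = *-assoc
        ; *-identity = *-idˡ , *-identityʳ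
        ; distrib = distribˡ , distribʳ }
      ; *-comm = *-comm } }

  open CommutativeRing commutativeRing public
    using (zeroˡ; zeroʳ; ring; semiring; +-abelianGroup)
  open import Algebra.Properties.Ring ring public
    using (-‿distribˡ-*; -‿distribʳ-*; -‿involutive; -0#≈0#)
  open import Algebra.Properties.AbelianGroup +-abelianGroup using (⁻¹-∙-comm)
  open import Algebra.Properties.Semiring.Mult semiring
    using (×-homo-+; ×1-homo-*) renaming (_×_ to _×ₙ_)

  neg-distrib-+ : ∀ x y → - (x + y) ≡ - x + - y
  neg-distrib-+ x y = sym (⁻¹-∙-comm x y)

  +-interchange : ∀ p q r s → (p + q) + (r + s) ≡ (p + r) + (q + s)
  +-interchange p q r s = begin
    (p + q) + (r + s) ≡⟨ +-assoc p q (r + s) ⟩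
    p + (q + (r + s)) ≡⟨ cong (p +_) (sym (+-assoc q r s)) ⟩
    p + ((q + r) + s) ≡⟨ cong (λ v → p + (v + s)) (+-comm q r) ⟩
    p + ((r + q) + s) ≡⟨ cong (p +_) (+-assoc r q s) ⟩
    p + (r + (q + s)) ≡⟨ sym (+-assoc p r (q + s)) ⟩
    (p + r) + (q + s) ∎
    where open ≡-Reasoning

  -- The ring solver needs integer coefficients with decidable equality: the pair
  -- (a , b) stands for a − b and is kept in lowest terms, so that pairs denoting
  -- the same integer are identical.
  private
    lowest : ℕ × ℕ → ℕ × ℕ
    lowest (suc a , suc b) = lowest (a , b)
    lowest p               = p

    integers : RawRing 0ℓ 0ℓ
    integers = record
      { Carrier = ℕ × ℕ ; _≈_ = _≡_
      ; _+_ = λ { (a , b) (c , d) → lowest (a ℕ.+ c , b ℕ.+ d) }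
      ; _*_ = λ { (a , b) (c , d) → lowest (a ℕ.* c ℕ.+ b ℕ.* d , a ℕ.* d ℕ.+ b ℕ.* c) }
      ; -_ = λ { (a , b) → (b , a) }
      ; 0# = (0 , 0) ; 1# = (1 , 0) }

    ⟦_⟧ℤ : ℕ × ℕ → Carrier
    ⟦ a , b ⟧ℤ = (a ×ₙ 1#) + - (b ×ₙ 1#)

    ⟦lowest⟧ : ∀ p → ⟦ lowest p ⟧ℤ ≡ ⟦ p ⟧ℤ
    ⟦lowest⟧ (suc a , suc b) = trans (⟦lowest⟧ (a , b)) (sym (begin
      (1# + A) + - (1# + B)      ≡⟨ cong ((1# + A) +_) (neg-distrib-+ 1# B) ⟩
      (1# + A) + (- 1# + - B)    ≡⟨ +-interchange 1# A (- 1#) (- B) ⟩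
      (1# + - 1#) + (A + - B)    ≡⟨ cong (_+ (A + - B)) (-‿inverseʳ 1#) ⟩
      0# + (A + - B)             ≡⟨ +-idˡ _ ⟩
      A + - B                    ∎))
      where open ≡-Reasoning
            A = a ×ₙ 1#
            B = b ×ₙ 1#
    ⟦lowest⟧ (0 , b)     = refl
    ⟦lowest⟧ (suc a , 0) = refl

    +-cancel-diff : ∀ x y z → (x + y) + - (y + z) ≡ x + - z
    +-cancel-diff x y z = begin
      (x + y) + - (y + z)       ≡⟨ cong ((x + y) +_) (neg-distrib-+ y z) ⟩
      (x + y) + (- y + - z)     ≡⟨ +-interchange x y (- y) (- z) ⟩
      (x + - y) + (y + - z)     ≡⟨ +-assoc x (- y) _ ⟩
      x + (- y + (y + - z))     ≡⟨ cong (x +_) (sym (+-assoc (- y) y (- z))) ⟩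
      x + ((- y + y) + - z)     ≡⟨ cong (λ v → x + (v + - z)) (-‿invˡ y) ⟩
      x + (0# + - z)            ≡⟨ cong (x +_) (+-idˡ (- z)) ⟩
      x + - z                   ∎
      where open ≡-Reasoning

    ⟦-⟧-diff : ∀ {A B C D} → A + D ≡ C + B → A + - B ≡ C + - D
    ⟦-⟧-diff {A} {B} {C} {D} e = begin
      A + - B               ≡⟨ sym (+-cancel-diff A D B) ⟩
      (A + D) + - (D + B)   ≡⟨ cong₂ (λ u v → u + - v) e (+-comm D B) ⟩
      (C + B) + - (B + D)   ≡⟨ +-cancel-diff C B D ⟩
      C + - D               ∎
      where open ≡-Reasoning

    ⟦*⟧ : ∀ a b c d → ⟦ a ℕ.* c ℕ.+ b ℕ.* d , a ℕ.* d ℕ.+ b ℕ.* c ⟧ℤ ≡ ⟦ a , b ⟧ℤ * ⟦ c , d ⟧ℤ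
    ⟦*⟧ a b c d = begin
      ((a ℕ.* c ℕ.+ b ℕ.* d) ×ₙ 1#) + - ((a ℕ.* d ℕ.+ b ℕ.* c) ×ₙ 1#)
        ≡⟨ cong₂ (λ u v → u + - v) (homo a c b d) (homo a d b c) ⟩
      (A * C + B * D) + - (A * D + B * C)           ≡⟨ cong ((A * C + B * D) +_) (neg-distrib-+ _ _) ⟩
      (A * C + B * D) + (- (A * D) + - (B * C))     ≡⟨ +-interchange _ _ _ _ ⟩
      (A * C + - (A * D)) + (B * D + - (B * C))     ≡⟨ cong ((A * C + - (A * D)) +_) (+-comm _ _) ⟩
      (A * C + - (A * D)) + (- (B * C) + B * D)
        ≡⟨ cong₂ _+_ (cong (A * C +_) (-‿distribʳ-* A D))
                     (cong₂ _+_ (-‿distribˡ-* B C) (trans (sym (-‿involutive _)) (cong (λ v → - v) (-‿distribˡ-* B D)))) ⟩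
      (A * C + A * - D) + (- B * C + - (- B * D))   ≡⟨ cong ((A * C + A * - D) +_) (cong (- B * C +_) (-‿distribʳ-* (- B) D)) ⟩
      (A * C + A * - D) + (- B * C + - B * - D)     ≡⟨ cong₂ _+_ (sym (distribˡ A C (- D))) (sym (distribˡ (- B) C (- D))) ⟩
      A * (C + - D) + - B * (C + - D)               ≡⟨ sym (distribʳ _ A (- B)) ⟩
      (A + - B) * (C + - D)                         ∎
      where open ≡-Reasoning
            A = a ×ₙ 1#
            B = b ×ₙ 1#
            C = c ×ₙ 1#
            D = d ×ₙ 1#
            homo : ∀ p q r s → ((p ℕ.* q ℕ.+ r ℕ.* s) ×ₙ 1#) ≡ (p ×ₙ 1#) * (q ×ₙ 1#) + (r ×ₙ 1#) * (s ×ₙ 1#)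
            homo p q r s = trans (×-homo-+ 1# (p ℕ.* q) (r ℕ.* s)) (cong₂ _+_ (×1-homo-* p q) (×1-homo-* r s))

    integers⟶ℝ : integers -Raw-AlmostCommutative⟶ fromCommutativeRing commutativeRing
    integers⟶ℝ = record
      { ⟦_⟧ = ⟦_⟧ℤ
      ; +-homo = λ { (a , b) (c , d) → trans (⟦lowest⟧ (a ℕ.+ c , b ℕ.+ d)) (begin
          ((a ℕ.+ c) ×ₙ 1#) + - ((b ℕ.+ d) ×ₙ 1#)
            ≡⟨ cong₂ (λ u v → u + - v) (×-homo-+ 1# a c) (×-homo-+ 1# b d) ⟩
          ((a ×ₙ 1#) + (c ×ₙ 1#)) + - ((b ×ₙ 1#) + (d ×ₙ 1#))
            ≡⟨ cong (((a ×ₙ 1#) + (c ×ₙ 1#)) +_) (neg-distrib-+ _ _) ⟩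
          ((a ×ₙ 1#) + (c ×ₙ 1#)) + (- (b ×ₙ 1#) + - (d ×ₙ 1#))
            ≡⟨ +-interchange _ _ _ _ ⟩
          ⟦ a , b ⟧ℤ + ⟦ c , d ⟧ℤ ∎) }
      ; *-homo = λ { (a , b) (c , d) →
          trans (⟦lowest⟧ (a ℕ.* c ℕ.+ b ℕ.* d , a ℕ.* d ℕ.+ b ℕ.* c)) (⟦*⟧ a b c d) }
      ; -‿homo = λ { (a , b) → begin
          (b ×ₙ 1#) + - (a ×ₙ 1#)       ≡⟨ +-comm _ _ ⟩
          - (a ×ₙ 1#) + (b ×ₙ 1#)       ≡⟨ cong (- (a ×ₙ 1#) +_) (sym (-‿involutive _)) ⟩
          - (a ×ₙ 1#) + - - (b ×ₙ 1#)   ≡⟨ sym (neg-distrib-+ _ _) ⟩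
          - ⟦ a , b ⟧ℤ                   ∎ }
      ; 0-homo = trans (cong (0# +_) -0#≈0#) (+-idˡ 0#)
      ; 1-homo = trans (cong₂ _+_ (+-identityʳ 1#) -0#≈0#) (+-identityʳ 1#) }
      where open ≡-Reasoning

    _≟ℤ_ : ∀ p q → Maybe (⟦ p ⟧ℤ ≡ ⟦ q ⟧ℤ)
    (a , b) ≟ℤ (c , d) with a ℕ.+ d ℕ.≟ c ℕ.+ b
    ... | no _  = nothing
    ... | yes e = just (⟦-⟧-diff (trans (sym (×-homo-+ 1# a d))
                                  (trans (cong (_×ₙ 1#) e) (×-homo-+ 1# c b))))

  open import Algebra.Solver.Ring integers (fromCommutativeRing commutativeRing) integers⟶ℝ _≟ℤ_
    public using (solve; _:+_; _:*_; :-_; _:-_; _:=_)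

  ≤-refl : ∀ {x} → x ≤ x
  ≤-refl = inj₂ refl

  <-≤-trans : ∀ {x y z} → x < y → y ≤ z → x < z
  <-≤-trans p (inj₁ q)    = <-trans _ _ _ p q
  <-≤-trans p (inj₂ refl) = p

  ≤-trans : ∀ {x y z} → x ≤ y → y ≤ z → x ≤ z
  ≤-trans (inj₁ p)    q = inj₁ (<-≤-trans p q)
  ≤-trans (inj₂ refl) q = q

  <⇒≢ : ∀ {x y} → x < y → x ≢ y
  <⇒≢ {x} p refl = <-irrefl x p

  <⇒≱ : ∀ {x y} → x < y → ¬ (y ≤ x)
  <⇒≱ {x} p q = <-irrefl x (<-≤-trans p q)

  <⇒0<- : ∀ {x y} → x < y → 0# < y - x
  <⇒0<- {x} {y} p = subst₂ _<_ (-‿inverseʳ x) refl (+-mono-< x y (- x) p)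

  0<-⇒< : ∀ {x y} → 0# < y - x → x < y
  0<-⇒< {x} {y} p = subst₂ _<_ (+-idˡ x) (solve 2 (λ x y → (y :- x) :+ x := y) refl x y)
                            (+-mono-< 0# (y - x) x p)

  ≤⇒0≤- : ∀ {x y} → x ≤ y → 0# ≤ y - x
  ≤⇒0≤- (inj₁ p)          = inj₁ (<⇒0<- p)
  ≤⇒0≤- {x} (inj₂ refl)   = inj₂ (sym (-‿inverseʳ x))

  0≤-⇒≤ : ∀ {x y} → 0# ≤ y - x → x ≤ y
  0≤-⇒≤ (inj₁ p)         = inj₁ (0<-⇒< p)
  0≤-⇒≤ {x} {y} (inj₂ e) = inj₂ (sym (trans (solve 2 (λ x y → y := (y :- x) :+ x) refl x y)
                                            (trans (cong (_+ x) (sym e)) (+-idˡ x))))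

  <⇒-<0 : ∀ {x y} → x < y → x - y < 0#
  <⇒-<0 {x} {y} p = subst (x - y <_) (-‿inverseʳ y) (+-mono-< x y (- y) p)

  -<0⇒< : ∀ {x y} → x - y < 0# → x < y
  -<0⇒< {x} {y} p = subst₂ _<_ (solve 2 (λ x y → (x :- y) :+ y := x) refl x y) (+-idˡ y) (+-mono-< _ 0# y p)

  ≡⇒-≡0 : ∀ {x y} → x ≡ y → x - y ≡ 0#
  ≡⇒-≡0 {x} refl = -‿inverseʳ x

  -≡0⇒≡ : ∀ {x y} → x - y ≡ 0# → x ≡ y
  -≡0⇒≡ {x} {y} e = trans (solve 2 (λ x y → x := (x :- y) :+ y) refl x y) (trans (cong (_+ y) e) (+-idˡ y))

  neg-antimono-< : ∀ {x y} → x < y → - y < - x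
  neg-antimono-< {x} {y} p = subst₂ _<_ (solve 2 (λ x y → x :+ (:- x :+ :- y) := :- y) refl x y)
                                        (solve 2 (λ x y → y :+ (:- x :+ :- y) := :- x) refl x y)
                                        (+-mono-< x y (- x + - y) p)

  x<0⇒0<-x : ∀ {x} → x < 0# → 0# < - x
  x<0⇒0<-x p = subst₂ _<_ -0#≈0# refl (neg-antimono-< p)

  0<-x⇒x<0 : ∀ {x} → 0# < - x → x < 0#
  0<-x⇒x<0 {x} p = subst₂ _<_ (-‿involutive x) -0#≈0# (neg-antimono-< p)

  +-pos-nonneg : ∀ {x y} → 0# < x → 0# ≤ y → 0# < x + y
  +-pos-nonneg {x} {y} p (inj₁ q) =
    <-trans _ _ _ p (subst₂ _<_ (+-idˡ x) (+-comm y x) (+-mono-< 0# y x q))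
  +-pos-nonneg {x} p (inj₂ refl) = subst (0# <_) (sym (+-identityʳ x)) p

  *-nonneg : ∀ {x y} → 0# ≤ x → 0# ≤ y → 0# ≤ x * y
  *-nonneg (inj₁ p) (inj₁ q)         = inj₁ (*-pos _ _ p q)
  *-nonneg {x} (inj₁ p) (inj₂ refl)  = inj₂ (sym (zeroʳ x))
  *-nonneg {y = y} (inj₂ refl) q     = inj₂ (sym (zeroˡ y))

  *-pos-neg : ∀ {x y} → 0# < x → y < 0# → x * y < 0#
  *-pos-neg {x} {y} p q = 0<-x⇒x<0 (subst (0# <_) (sym (-‿distribʳ-* x y)) (*-pos _ _ p (x<0⇒0<-x q)))

  x≢0⇒0<x*x : ∀ x → x ≢ 0# → 0# < x * x
  x≢0⇒0<x*x x x≢0 with <-tri x 0#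
  ... | inj₁ p        = subst (0# <_) (solve 1 (λ x → :- x :* :- x := x :* x) refl x)
                              (*-pos _ _ (x<0⇒0<-x p) (x<0⇒0<-x p))
  ... | inj₂ (inj₁ e) = ⊥-elim (x≢0 e)
  ... | inj₂ (inj₂ p) = *-pos _ _ p p

  0≤x*x : ∀ x → 0# ≤ x * x
  0≤x*x x with <-tri x 0#
  ... | inj₂ (inj₁ refl) = inj₂ (sym (zeroˡ 0#))
  ... | inj₁ p           = inj₁ (x≢0⇒0<x*x x (<⇒≢ p))
  ... | inj₂ (inj₂ p)    = inj₁ (x≢0⇒0<x*x x (λ e → <⇒≢ p (sym e)))

  0<1 : 0# < 1#
  0<1 = subst (0# <_) (*-idˡ 1#) (x≢0⇒0<x*x 1# (λ e → 0≢1 (sym e)))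

  max-attained : ∀ {A : Set} (f : A → Carrier) a b → Σ A λ c →
                 f a ≤ f c × f b ≤ f c × (∀ {y} → f a ≤ y → f b ≤ y → f c ≤ y)
  max-attained f a b with <-tri (f a) (f b)
  ... | inj₁ p        = b , inj₁ p , ≤-refl , λ _ q → q
  ... | inj₂ (inj₁ q) = b , inj₂ q , ≤-refl , λ _ r → r
  ... | inj₂ (inj₂ p) = a , ≤-refl , inj₁ p , λ q _ → q

  min-attained : ∀ {A : Set} (f : A → Carrier) a b → Σ A λ c →
                 f c ≤ f a × f c ≤ f b × (∀ {y} → y ≤ f a → y ≤ f b → y ≤ f c)
  min-attained f a b with <-tri (f a) (f b)
  ... | inj₁ p        = a , ≤-refl , inj₁ p , λ q _ → q
  ... | inj₂ (inj₁ q) = a , ≤-refl , inj₂ q , λ q _ → q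
  ... | inj₂ (inj₂ p) = b , inj₁ p , ≤-refl , λ _ r → r

  recip : ∀ x → x ≢ 0# → Carrier
  recip x x≢0 = proj₁ (inverse x x≢0)

  *-recip : ∀ x x≢0 → x * recip x x≢0 ≡ 1#
  *-recip x x≢0 = proj₂ (inverse x x≢0)

  *≡1⇒pos : ∀ {x y} → 0# < x → x * y ≡ 1# → 0# < y
  *≡1⇒pos {x} {y} 0<x xy≡1 with <-tri y 0#
  ... | inj₂ (inj₂ 0<y)  = 0<y
  ... | inj₂ (inj₁ refl) = ⊥-elim (0≢1 (trans (sym (zeroʳ x)) xy≡1))
  ... | inj₁ y<0         = ⊥-elim (<⇒≢ (<-trans _ _ _ (*-pos-neg 0<x y<0) 0<1) xy≡1)

  *-cancelʳ : ∀ {a b} c → c ≢ 0# → a * c ≡ b * c → a ≡ b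
  *-cancelʳ {a} {b} c c≢0 e = begin
    a                 ≡⟨ sym (*-identityʳ a) ⟩
    a * 1#            ≡⟨ cong (a *_) (sym (*-recip c c≢0)) ⟩
    a * (c * c⁻¹)     ≡⟨ sym (*-assoc a c c⁻¹) ⟩
    (a * c) * c⁻¹     ≡⟨ cong (_* c⁻¹) e ⟩
    (b * c) * c⁻¹     ≡⟨ *-assoc b c c⁻¹ ⟩
    b * (c * c⁻¹)     ≡⟨ cong (b *_) (*-recip c c≢0) ⟩
    b * 1#            ≡⟨ *-identityʳ b ⟩
    b                 ∎
    where open ≡-Reasoning
          c⁻¹ = recip c c≢0

  -- The solver sees 1# only as a variable; the identities below that need
  -- 1# * z ≡ z go through this lemma.
  [1-s]*z : ∀ s z → (1# - s) * z ≡ z - (s * z)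
  [1-s]*z s z = trans (solve 3 (λ o s z → (o :- s) :* z := o :* z :- s :* z) refl 1# s z)
                      (cong (_- (s * z)) (*-idˡ z))

  lerp : Carrier → Carrier → Carrier → Carrier
  lerp a b s = a + s * (b - a)

  lerp-const : ∀ a s → lerp a a s ≡ a
  lerp-const = solve 2 (λ a s → a :+ s :* (a :- a) := a) refl

  lerp-sym : ∀ a b s → lerp a b s ≡ lerp b a (1# - s)
  lerp-sym a b s = trans (solve 3 (λ s a b → a :+ s :* (b :- a) := b :+ ((a :- b) :- s :* (a :- b))) refl s a b)
                         (cong (b +_) (sym ([1-s]*z s (a - b))))

  lerp-solve : ∀ a b y {i} → (b - a) * i ≡ 1# → lerp a b ((y - a) * i) ≡ y
  lerp-solve a b y {i} e = begin
    a + ((y - a) * i) * (b - a)   ≡⟨ cong (a +_) (solve 4 (λ a b y i → ((y :- a) :* i) :* (b :- a) := (y :- a) :* ((b :- a) :* i)) refl a b y i) ⟩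
    a + (y - a) * ((b - a) * i)   ≡⟨ cong (λ v → a + (y - a) * v) e ⟩
    a + (y - a) * 1#              ≡⟨ cong (a +_) (*-identityʳ (y - a)) ⟩
    a + (y - a)                   ≡⟨ solve 2 (λ a y → a :+ (y :- a) := y) refl a y ⟩
    y                             ∎
    where open ≡-Reasoning

  lerp-convex : ∀ u v s → lerp u v s ≡ (1# - s) * u + s * v
  lerp-convex u v s = trans (solve 3 (λ u v s → u :+ s :* (v :- u) := (u :- s :* u) :+ s :* v) refl u v s)
                            (cong (_+ s * v) (sym ([1-s]*z s u)))

  lerp-pos : ∀ {u v s} → 0# ≤ s → s ≤ 1# → 0# < u → 0# < v → 0# < lerp u v s
  lerp-pos {u} {v} {s} (inj₁ 0<s) s≤1 0<u 0<v =
    subst (0# <_) (trans (+-comm _ _) (sym (lerp-convex u v s)))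
          (+-pos-nonneg (*-pos _ _ 0<s 0<v) (*-nonneg (≤⇒0≤- s≤1) (inj₁ 0<u)))
  lerp-pos {u} {v} (inj₂ refl) _ 0<u _ =
    subst (0# <_) (sym (trans (cong (u +_) (zeroˡ _)) (+-identityʳ u))) 0<u

  lerp-neg : ∀ a b s → - lerp a b s ≡ lerp (- a) (- b) s
  lerp-neg = solve 3 (λ a b s → :- (a :+ s :* (b :- a)) := :- a :+ s :* (:- b :- :- a)) refl

  lerp-sub : ∀ a b c d s → lerp a b s - lerp c d s ≡ lerp (a - c) (b - d) s
  lerp-sub = solve 5 (λ a b c d s → (a :+ s :* (b :- a)) :- (c :+ s :* (d :- c))
                                    := (a :- c) :+ s :* ((b :- d) :- (a :- c))) refl

  lerp-a : ∀ a b s → lerp a b s - a ≡ s * (b - a)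
  lerp-a = solve 3 (λ a b s → (a :+ s :* (b :- a)) :- a := s :* (b :- a)) refl

  b-lerp : ∀ a b s → b - lerp a b s ≡ (1# - s) * (b - a)
  b-lerp a b s = trans (solve 3 (λ a b s → b :- (a :+ s :* (b :- a)) := (b :- a) :- s :* (b :- a)) refl a b s)
                       (sym ([1-s]*z s (b - a)))

  lerp-strict : ∀ {a b s} → 0# < s → s < 1# → a < b → a < lerp a b s × lerp a b s < b
  lerp-strict {a} {b} {s} 0<s s<1 a<b =
    0<-⇒< (subst (0# <_) (sym (lerp-a a b s)) (*-pos _ _ 0<s (<⇒0<- a<b))) ,
    0<-⇒< (subst (0# <_) (sym (b-lerp a b s)) (*-pos _ _ (<⇒0<- s<1) (<⇒0<- a<b)))

  lerp-between : ∀ {a b s} → 0# ≤ s → s ≤ 1# → a < b → a ≤ lerp a b s × lerp a b s ≤ b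
  lerp-between {a} {b} {s} 0≤s s≤1 a<b =
    0≤-⇒≤ (subst (0# ≤_) (sym (lerp-a a b s)) (*-nonneg 0≤s (inj₁ (<⇒0<- a<b)))) ,
    0≤-⇒≤ (subst (0# ≤_) (sym (b-lerp a b s)) (*-nonneg (≤⇒0≤- s≤1) (inj₁ (<⇒0<- a<b))))

  1-[y-a]*κ : ∀ a b y {κ} → (b - a) * κ ≡ 1# → 1# - ((y - a) * κ) ≡ (b - y) * κ
  1-[y-a]*κ a b y {κ} e = trans (cong (_- ((y - a) * κ)) (sym e))
    (solve 4 (λ a b y κ → (b :- a) :* κ :- (y :- a) :* κ := (b :- y) :* κ) refl a b y κ)

  lerp-onto : ∀ {a b y} → a < y → y < b → Σ Carrier λ s → 0# < s × s < 1# × lerp a b s ≡ y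
  lerp-onto {a} {b} {y} a<y y<b =
    (y - a) * κ , *-pos _ _ (<⇒0<- a<y) 0<κ , s<1 , lerp-solve a b y κ-inv
    where
    0<b-a = <⇒0<- (<-trans _ _ _ a<y y<b)
    κ = recip (b - a) (λ e → <⇒≢ 0<b-a (sym e))
    κ-inv = *-recip (b - a) _
    0<κ = *≡1⇒pos 0<b-a κ-inv
    s<1 : (y - a) * κ < 1#
    s<1 = 0<-⇒< (subst (0# <_) (sym (1-[y-a]*κ a b y κ-inv)) (*-pos _ _ (<⇒0<- y<b) 0<κ))

  data Sign : Set where
    negative null positive : Sign

  HasSign : Carrier → Sign → Set
  HasSign x negative = x < 0#
  HasSign x null     = x ≡ 0#
  HasSign x positive = 0# < x

  sign : ∀ x → Σ Sign (HasSign x)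
  sign x with <-tri x 0#
  ... | inj₁ x<0        = negative , x<0
  ... | inj₂ (inj₁ x≡0) = null , x≡0
  ... | inj₂ (inj₂ 0<x) = positive , 0<x

  HasSign-unique : ∀ {x} σ τ → HasSign x σ → HasSign x τ → σ ≡ τ
  HasSign-unique negative negative _ _ = refl
  HasSign-unique null     null     _ _ = refl
  HasSign-unique positive positive _ _ = refl
  HasSign-unique negative null     p refl = ⊥-elim (<-irrefl _ p)
  HasSign-unique null     negative refl p = ⊥-elim (<-irrefl _ p)
  HasSign-unique null     positive refl p = ⊥-elim (<-irrefl _ p)
  HasSign-unique positive null     p refl = ⊥-elim (<-irrefl _ p)
  HasSign-unique negative positive p q = ⊥-elim (<-irrefl _ (<-trans _ _ _ p q))
  HasSign-unique positive negative p q = ⊥-elim (<-irrefl _ (<-trans _ _ _ p q))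

  HasSign-lerp : ∀ {a b s} σ → 0# ≤ s → s ≤ 1# → HasSign a σ → HasSign b σ → HasSign (lerp a b s) σ
  HasSign-lerp {a} {b} {s} negative 0≤s s≤1 a<0 b<0 =
    0<-x⇒x<0 (subst (0# <_) (sym (lerp-neg a b s)) (lerp-pos 0≤s s≤1 (x<0⇒0<-x a<0) (x<0⇒0<-x b<0)))
  HasSign-lerp {s = s} null     _   _   refl refl = lerp-const 0# s
  HasSign-lerp positive 0≤s s≤1 0<a 0<b = lerp-pos 0≤s s≤1 0<a 0<b

  HasSign-*-pos : ∀ {c x} σ → 0# < c → HasSign x σ → HasSign (c * x) σ
  HasSign-*-pos negative 0<c x<0 = *-pos-neg 0<c x<0
  HasSign-*-pos {c} null _   refl = zeroʳ c
  HasSign-*-pos positive 0<c 0<x = *-pos _ _ 0<c 0<x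

  lerp-0ˡ : ∀ b s → lerp 0# b s ≡ s * b
  lerp-0ˡ b s = trans (+-idˡ _) (cong (s *_) (trans (cong (b +_) -0#≈0#) (+-identityʳ b)))

  HasSign-lerp-0ˡ : ∀ {b s} σ → 0# < s → HasSign b σ → HasSign (lerp 0# b s) σ
  HasSign-lerp-0ˡ {b} {s} σ 0<s hb = subst (λ v → HasSign v σ) (sym (lerp-0ˡ b s)) (HasSign-*-pos σ 0<s hb)

  HasSign-lerp-0ʳ : ∀ {a s} σ → s < 1# → HasSign a σ → HasSign (lerp a 0# s) σ
  HasSign-lerp-0ʳ {a} {s} σ s<1 ha =
    subst (λ v → HasSign v σ) (sym (lerp-sym a 0# s)) (HasSign-lerp-0ˡ σ (<⇒0<- s<1) ha)

  lerp-root-flip : ∀ {a b} → (Σ Carrier λ r → 0# < r × r < 1# × lerp b a r ≡ 0#) →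
                   Σ Carrier λ r → 0# < r × r < 1# × lerp a b r ≡ 0#
  lerp-root-flip {a} {b} (r , 0<r , r<1 , root) =
    1# - r , <⇒0<- r<1 , 0<-⇒< (subst (0# <_) (sym 1-[1-r]) 0<r) ,
    trans (lerp-sym a b (1# - r)) (trans (cong (lerp b a) 1-[1-r]) root)
    where 1-[1-r] : 1# - (1# - r) ≡ r
          1-[1-r] = solve 2 (λ o r → o :- (o :- r) := r) refl 1# r

  lerp-root-by-signs : ∀ {a b a' b' s} σ τ → HasSign a σ → HasSign a' σ → HasSign b τ → HasSign b' τ →
                       0# < s → s < 1# → lerp a b s ≡ 0# →
                       Σ Carrier λ r → 0# < r × r < 1# × lerp a' b' r ≡ 0#
  lerp-root-by-signs {s = s} null null _ refl _ refl 0<s s<1 _ = s , 0<s , s<1 , lerp-const 0# s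
  lerp-root-by-signs negative positive _ a'<0 _ 0<b' _ _ _ = lerp-onto a'<0 0<b'
  lerp-root-by-signs positive negative _ 0<a' _ b'<0 _ _ _ = lerp-root-flip (lerp-onto b'<0 0<a')
  lerp-root-by-signs negative negative a<0 _ b<0 _ 0<s s<1 root =
    ⊥-elim (<⇒≢ (HasSign-lerp negative (inj₁ 0<s) (inj₁ s<1) a<0 b<0) root)
  lerp-root-by-signs positive positive 0<a _ 0<b _ 0<s s<1 root =
    ⊥-elim (<⇒≢ (HasSign-lerp positive (inj₁ 0<s) (inj₁ s<1) 0<a 0<b) (sym root))
  lerp-root-by-signs null negative refl _ b<0 _ 0<s _ root = ⊥-elim (<⇒≢ (HasSign-lerp-0ˡ negative 0<s b<0) root)
  lerp-root-by-signs null positive refl _ 0<b _ 0<s _ root = ⊥-elim (<⇒≢ (HasSign-lerp-0ˡ positive 0<s 0<b) (sym root))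
  lerp-root-by-signs negative null a<0 _ refl _ _ s<1 root = ⊥-elim (<⇒≢ (HasSign-lerp-0ʳ negative s<1 a<0) root)
  lerp-root-by-signs positive null 0<a _ refl _ _ s<1 root = ⊥-elim (<⇒≢ (HasSign-lerp-0ʳ positive s<1 0<a) (sym root))

module LevelGeometry (ℝ : RealField) (H : HierGraph ℝ) where
  open RealField ℝ
  open RealFieldProperties ℝ
  open HierGraph H

  private
    P : Set
    P = Point ℝ

    infixl 6 _⊕ₚ_ _⊖ₚ_
    infixl 7 _⊗ₚ_

    _⊕ₚ_ _⊖ₚ_ : P → P → P
    _⊕ₚ_ = _⊕_ ℝ
    _⊖ₚ_ = _⊖_ ℝ

    _⊗ₚ_ : Carrier → P → P
    _⊗ₚ_ = _⊗_ ℝ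

  height abscissa : P → Carrier
  height p   = dot ℝ p dir
  abscissa p = dot ℝ p (lineDir ℝ H)

  dot-lerp : ∀ A B s w → dot ℝ (A ⊕ₚ s ⊗ₚ (B ⊖ₚ A)) w ≡ lerp (dot ℝ A w) (dot ℝ B w) s
  dot-lerp (a₁ , a₂) (b₁ , b₂) s (w₁ , w₂) =
    solve 7 (λ w₁ w₂ a₁ a₂ b₁ b₂ s →
               (a₁ :+ s :* (b₁ :- a₁)) :* w₁ :+ (a₂ :+ s :* (b₂ :- a₂)) :* w₂
               := (a₁ :* w₁ :+ a₂ :* w₂) :+ s :* ((b₁ :* w₁ :+ b₂ :* w₂) :- (a₁ :* w₁ :+ a₂ :* w₂)))
            refl w₁ w₂ a₁ a₂ b₁ b₂ s

  dot-⊖ : ∀ A B w → dot ℝ (A ⊖ₚ B) w ≡ dot ℝ A w - dot ℝ B w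
  dot-⊖ (a₁ , a₂) (b₁ , b₂) (w₁ , w₂) =
    solve 6 (λ a₁ a₂ b₁ b₂ w₁ w₂ → (a₁ :- b₁) :* w₁ :+ (a₂ :- b₂) :* w₂ := (a₁ :* w₁ :+ a₂ :* w₂) :- (b₁ :* w₁ :+ b₂ :* w₂))
            refl a₁ a₂ b₁ b₂ w₁ w₂

  dot-morph : ∀ A B t w → dot ℝ ((1# - t) ⊗ₚ A ⊕ₚ t ⊗ₚ B) w ≡ lerp (dot ℝ A w) (dot ℝ B w) t
  dot-morph (a₁ , a₂) (b₁ , b₂) t (w₁ , w₂) =
    trans (solve 8 (λ o t a₁ a₂ b₁ b₂ w₁ w₂ →
                      ((o :- t) :* a₁ :+ t :* b₁) :* w₁ :+ ((o :- t) :* a₂ :+ t :* b₂) :* w₂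
                      := o :* (a₁ :* w₁ :+ a₂ :* w₂) :+ t :* ((b₁ :* w₁ :+ b₂ :* w₂) :- (a₁ :* w₁ :+ a₂ :* w₂)))
                   refl 1# t a₁ a₂ b₁ b₂ w₁ w₂)
          (cong (_+ t * ((b₁ * w₁ + b₂ * w₂) - (a₁ * w₁ + a₂ * w₂))) (*-idˡ _))

  0<|p|² : ∀ p → p ≢ origin ℝ → 0# < dot ℝ p p
  0<|p|² (a , b) p≢0 with <-tri a 0#
  ... | inj₁ a<0        = +-pos-nonneg (x≢0⇒0<x*x a (<⇒≢ a<0)) (0≤x*x b)
  ... | inj₂ (inj₂ 0<a) = +-pos-nonneg (x≢0⇒0<x*x a (λ e → <⇒≢ 0<a (sym e))) (0≤x*x b)
  ... | inj₂ (inj₁ refl) with <-tri b 0#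
  ...   | inj₁ b<0         = subst (0# <_) (+-comm _ _) (+-pos-nonneg (x≢0⇒0<x*x b (<⇒≢ b<0)) (0≤x*x 0#))
  ...   | inj₂ (inj₂ 0<b)  = subst (0# <_) (+-comm _ _) (+-pos-nonneg (x≢0⇒0<x*x b (λ e → <⇒≢ 0<b (sym e))) (0≤x*x 0#))
  ...   | inj₂ (inj₁ refl) = ⊥-elim (p≢0 refl)

  |dir|² : Carrier
  |dir|² = dot ℝ dir dir

  |dir|²≢0 : |dir|² ≢ 0#
  |dir|²≢0 e = <⇒≢ (0<|p|² dir dir≢0) (sym e)

  -- (dir, lineDir) is an orthogonal basis with both vectors of squared length |dir|².
  height-abscissa-injective : ∀ p q → height p ≡ height q → abscissa p ≡ abscissa q → p ≡ q
  height-abscissa-injective (p₁ , p₂) (q₁ , q₂) h≡ x≡ = cong₂ _,_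
    (*-cancelʳ |dir|² |dir|²≢0 (trans (first p₁ p₂) (trans (cong₂ (λ u v → d₁ * u + d₂ * v) h≡ x≡) (sym (first q₁ q₂)))))
    (*-cancelʳ |dir|² |dir|²≢0 (trans (second p₁ p₂) (trans (cong₂ (λ u v → d₂ * u + - (d₁ * v)) h≡ x≡) (sym (second q₁ q₂)))))
    where
    d₁ = proj₁ dir
    d₂ = proj₂ dir
    first : ∀ a b → a * |dir|² ≡ d₁ * height (a , b) + d₂ * abscissa (a , b)
    first a b = solve 4 (λ a b d₁ d₂ → a :* (d₁ :* d₁ :+ d₂ :* d₂)
                          := d₁ :* (a :* d₁ :+ b :* d₂) :+ d₂ :* (a :* d₂ :+ b :* (:- d₁))) refl a b d₁ d₂
    second : ∀ a b → b * |dir|² ≡ d₂ * height (a , b) + - (d₁ * abscissa (a , b))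
    second a b = solve 4 (λ a b d₁ d₂ → b :* (d₁ :* d₁ :+ d₂ :* d₂)
                           := d₂ :* (a :* d₁ :+ b :* d₂) :+ :- (d₁ :* (a :* d₂ :+ b :* (:- d₁)))) refl a b d₁ d₂

  lineDir≢origin : lineDir ℝ H ≢ origin ℝ
  lineDir≢origin eq = dir≢0 (cong₂ _,_ d₁≡0 (cong proj₁ eq))
    where d₁≡0 : proj₁ dir ≡ 0#
          d₁≡0 = trans (sym (-‿involutive (proj₁ dir))) (trans (cong (λ v → - v) (cong proj₂ eq)) -0#≈0#)

  height≡0⇒∥lineDir : ∀ p → height p ≡ 0# → p ≡ (abscissa p * recip |dir|² |dir|²≢0) ⊗ₚ lineDir ℝ H
  height≡0⇒∥lineDir p h≡0 = height-abscissa-injective _ _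
      (trans h≡0 (sym (trans (solve 3 (λ c d₁ d₂ → c :* d₂ :* d₁ :+ c :* (:- d₁) :* d₂ := c :- c) refl c d₁ d₂)
                             (-‿inverseʳ c))))
      (sym (begin
        c * d₂ * d₂ + c * - d₁ * - d₁  ≡⟨ solve 3 (λ c d₁ d₂ → c :* d₂ :* d₂ :+ c :* (:- d₁) :* (:- d₁) := c :* (d₁ :* d₁ :+ d₂ :* d₂)) refl c d₁ d₂ ⟩
        c * |dir|²                    ≡⟨ *-assoc _ _ _ ⟩
        abscissa p * (r * |dir|²)     ≡⟨ cong (abscissa p *_) (trans (*-comm r |dir|²) (*-recip _ _)) ⟩
        abscissa p * 1#               ≡⟨ *-identityʳ _ ⟩
        abscissa p                    ∎))
    where open ≡-Reasoning
          d₁ = proj₁ dir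
          d₂ = proj₂ dir
          r = recip |dir|² |dir|²≢0
          c = abscissa p * r

  -- With κ = 1 / (h₁ − h₀), the point of the line AB at height y, where A and B
  -- lie at heights h₀ and h₁.
  segmentAt : P → P → Carrier → Carrier → Carrier → P
  segmentAt A B h₀ κ y = A ⊕ₚ ((y - h₀) * κ) ⊗ₚ (B ⊖ₚ A)

  segmentAt-start : ∀ A B h₀ κ → segmentAt A B h₀ κ h₀ ≡ A
  segmentAt-start (a₁ , a₂) (b₁ , b₂) h₀ κ = cong₂ _,_ (at-h₀ a₁ b₁) (at-h₀ a₂ b₂)
    where at-h₀ : ∀ a b → a + ((h₀ - h₀) * κ) * (b - a) ≡ a
          at-h₀ a b = solve 4 (λ a b h₀ κ → a :+ ((h₀ :- h₀) :* κ) :* (b :- a) := a) refl a b h₀ κ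

  abscissa-segmentAt : ∀ A B h₀ κ y →
                       abscissa (segmentAt A B h₀ κ y) ≡ lerp (abscissa A) (abscissa B) ((y - h₀) * κ)
  abscissa-segmentAt A B h₀ κ y = dot-lerp A B _ _

  abscissa-segmentAt-lerp : ∀ A B h₀ κ y₁ y₂ s →
    abscissa (segmentAt A B h₀ κ (lerp y₁ y₂ s))
      ≡ lerp (abscissa (segmentAt A B h₀ κ y₁)) (abscissa (segmentAt A B h₀ κ y₂)) s
  abscissa-segmentAt-lerp A B h₀ κ y₁ y₂ s = begin
    abscissa (segmentAt A B h₀ κ (lerp y₁ y₂ s))
      ≡⟨ abscissa-segmentAt A B h₀ κ _ ⟩
    lerp a b ((lerp y₁ y₂ s - h₀) * κ)
      ≡⟨ solve 7 (λ a b h₀ κ y₁ y₂ s →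
                   a :+ (((y₁ :+ s :* (y₂ :- y₁)) :- h₀) :* κ) :* (b :- a)
                   := (a :+ ((y₁ :- h₀) :* κ) :* (b :- a))
                      :+ s :* ((a :+ ((y₂ :- h₀) :* κ) :* (b :- a)) :- (a :+ ((y₁ :- h₀) :* κ) :* (b :- a))))
                 refl a b h₀ κ y₁ y₂ s ⟩
    lerp (lerp a b ((y₁ - h₀) * κ)) (lerp a b ((y₂ - h₀) * κ)) s
      ≡⟨ sym (cong₂ (λ u v → lerp u v s) (abscissa-segmentAt A B h₀ κ y₁) (abscissa-segmentAt A B h₀ κ y₂)) ⟩
    lerp (abscissa (segmentAt A B h₀ κ y₁)) (abscissa (segmentAt A B h₀ κ y₂)) s ∎
    where open ≡-Reasoning
          a = abscissa A
          b = abscissa B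

  abscissa-segmentAt-morph : ∀ A₀ B₀ A₁ B₁ h₀ κ y t →
    abscissa (segmentAt ((1# - t) ⊗ₚ A₀ ⊕ₚ t ⊗ₚ A₁) ((1# - t) ⊗ₚ B₀ ⊕ₚ t ⊗ₚ B₁) h₀ κ y)
      ≡ lerp (abscissa (segmentAt A₀ B₀ h₀ κ y)) (abscissa (segmentAt A₁ B₁ h₀ κ y)) t
  abscissa-segmentAt-morph A₀ B₀ A₁ B₁ h₀ κ y t = begin
    _ ≡⟨ abscissa-segmentAt _ _ h₀ κ y ⟩
    lerp (abscissa ((1# - t) ⊗ₚ A₀ ⊕ₚ t ⊗ₚ A₁)) (abscissa ((1# - t) ⊗ₚ B₀ ⊕ₚ t ⊗ₚ B₁)) σ
      ≡⟨ cong₂ (λ u v → lerp u v σ) (dot-morph A₀ A₁ t _) (dot-morph B₀ B₁ t _) ⟩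
    lerp (lerp a₀ a₁ t) (lerp b₀ b₁ t) σ
      ≡⟨ solve 6 (λ a₀ a₁ b₀ b₁ σ t →
                   (a₀ :+ t :* (a₁ :- a₀)) :+ σ :* ((b₀ :+ t :* (b₁ :- b₀)) :- (a₀ :+ t :* (a₁ :- a₀)))
                   := (a₀ :+ σ :* (b₀ :- a₀)) :+ t :* ((a₁ :+ σ :* (b₁ :- a₁)) :- (a₀ :+ σ :* (b₀ :- a₀))))
                 refl a₀ a₁ b₀ b₁ σ t ⟩
    lerp (lerp a₀ b₀ σ) (lerp a₁ b₁ σ) t
      ≡⟨ sym (cong₂ (λ u v → lerp u v t) (abscissa-segmentAt A₀ B₀ h₀ κ y) (abscissa-segmentAt A₁ B₁ h₀ κ y)) ⟩
    _ ∎
    where open ≡-Reasoning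
          σ = (y - h₀) * κ
          a₀ = abscissa A₀
          a₁ = abscissa A₁
          b₀ = abscissa B₀
          b₁ = abscissa B₁

  OnSeg-sym : ∀ A B p → OnSeg ℝ A B p → OnSeg ℝ B A p
  OnSeg-sym (a₁ , a₂) (b₁ , b₂) p (σ , 0≤σ , σ≤1 , p≡) =
    1# - σ , ≤⇒0≤- σ≤1 ,
    0≤-⇒≤ (subst (0# ≤_) (sym (solve 2 (λ o σ → o :- (o :- σ) := σ) refl 1# σ)) 0≤σ) ,
    trans p≡ (cong₂ _,_ (lerp-sym a₁ b₁ σ) (lerp-sym a₂ b₂ σ))

  module Segment {A B : P} {h₀ h₁ κ : Carrier} (hA : height A ≡ h₀) (hB : height B ≡ h₁)
                 (h₀<h₁ : h₀ < h₁) (κ-inv : (h₁ - h₀) * κ ≡ 1#) where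

    at : Carrier → P
    at = segmentAt A B h₀ κ

    height-lerp : ∀ s → height (A ⊕ₚ s ⊗ₚ (B ⊖ₚ A)) ≡ lerp h₀ h₁ s
    height-lerp s = trans (dot-lerp A B s dir) (cong₂ (λ u v → lerp u v s) hA hB)

    height-at : ∀ y → height (at y) ≡ y
    height-at y = trans (height-lerp _) (lerp-solve h₀ h₁ y κ-inv)

    at-end : at h₁ ≡ B
    at-end = cong₂ _,_ (end (proj₁ A) (proj₁ B)) (end (proj₂ A) (proj₂ B))
      where end : ∀ a b → a + ((h₁ - h₀) * κ) * (b - a) ≡ b
            end a b = trans (cong (λ v → a + v * (b - a)) κ-inv)
                            (trans (cong (a +_) (*-idˡ _)) (solve 2 (λ a b → a :+ (b :- a) := b) refl a b))

    OnSeg⇒≡at : ∀ p → OnSeg ℝ A B p → p ≡ at (height p)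
    OnSeg⇒≡at p (σ , _ , _ , p≡) = trans p≡ (cong (λ v → A ⊕ₚ v ⊗ₚ (B ⊖ₚ A)) (sym σ≡))
      where σ≡ : (height p - h₀) * κ ≡ σ
            σ≡ = begin
              (height p - h₀) * κ             ≡⟨ cong (λ v → (v - h₀) * κ) (trans (cong height p≡) (height-lerp σ)) ⟩
              (lerp h₀ h₁ σ - h₀) * κ         ≡⟨ cong (_* κ) (lerp-a h₀ h₁ σ) ⟩
              (σ * (h₁ - h₀)) * κ             ≡⟨ *-assoc σ _ κ ⟩
              σ * ((h₁ - h₀) * κ)             ≡⟨ cong (σ *_) κ-inv ⟩
              σ * 1#                          ≡⟨ *-identityʳ σ ⟩
              σ                               ∎
              where open ≡-Reasoning

    OnSeg⇒height-between : ∀ p → OnSeg ℝ A B p → h₀ ≤ height p × height p ≤ h₁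
    OnSeg⇒height-between p (σ , 0≤σ , σ≤1 , p≡) =
      subst (λ v → h₀ ≤ v × v ≤ h₁) (sym (trans (cong height p≡) (height-lerp σ))) (lerp-between 0≤σ σ≤1 h₀<h₁)

    at-OnSeg : ∀ y → h₀ ≤ y → y ≤ h₁ → OnSeg ℝ A B (at y)
    at-OnSeg y h₀≤y y≤h₁ =
      (y - h₀) * κ , *-nonneg (≤⇒0≤- h₀≤y) (inj₁ 0<κ) ,
      0≤-⇒≤ (subst (0# ≤_) (sym (1-[y-a]*κ h₀ h₁ y κ-inv)) (*-nonneg (≤⇒0≤- y≤h₁) (inj₁ 0<κ))) , refl
      where 0<κ = *≡1⇒pos (<⇒0<- h₀<h₁) κ-inv

  lev-injective : ∀ {i j} → lev i ≡ lev j → i ≡ j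
  lev-injective {i} {j} e with Fin.<-cmp i j
  ... | tri< i<j _ _ = ⊥-elim (<⇒≢ (lev-< i j i<j) e)
  ... | tri≈ _ i≡j _ = i≡j
  ... | tri> _ _ j<i = ⊥-elim (<⇒≢ (lev-< j i j<i) (sym e))

  lev-<-reflects : ∀ {i j} → lev i < lev j → i <ᶠ j
  lev-<-reflects {i} {j} e with Fin.<-cmp i j
  ... | tri< i<j _ _    = i<j
  ... | tri≈ _ refl _   = ⊥-elim (<-irrefl _ e)
  ... | tri> _ _ j<i    = ⊥-elim (<⇒≱ e (inj₁ (lev-< j i j<i)))

  level : Fin n → Carrier
  level v = lev (γ v)

  record Orientation (e : Fin m) : Set where
    field
      lower upper : Fin n
      ends        : (lower ≡ end₁ e × upper ≡ end₂ e) ⊎ (lower ≡ end₂ e × upper ≡ end₁ e)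
      rising      : level lower < level upper

  orientation : ∀ e → Orientation e
  orientation e with <-tri (level (end₁ e)) (level (end₂ e))
  ... | inj₁ p        = record { lower = end₁ e ; upper = end₂ e ; ends = inj₁ (refl , refl) ; rising = p }
  ... | inj₂ (inj₁ q) = ⊥-elim (γ-edge e (lev-injective q))
  ... | inj₂ (inj₂ p) = record { lower = end₂ e ; upper = end₁ e ; ends = inj₂ (refl , refl) ; rising = p }

  module _ (e : Fin m) where
    open Orientation (orientation e) public using (lower; upper; ends; rising)

  bottom top : Fin m → Carrier
  bottom e = level (lower e)
  top e    = level (upper e)

  Spans : Fin m → Carrier → Set
  Spans e y = bottom e ≤ y × y ≤ top e

  IsEndpoint⇒lower⊎upper : ∀ {w e} → IsEndpoint ℝ H w e → w ≡ lower e ⊎ w ≡ upper e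
  IsEndpoint⇒lower⊎upper {w} {e} w-end with lower e | upper e | ends e
  ... | _ | _ | inj₁ (refl , refl) = w-end
  ... | _ | _ | inj₂ (refl , refl) = swap w-end

  IsEndpoint⇒level : ∀ {w e} → IsEndpoint ℝ H w e → level w ≡ bottom e ⊎ level w ≡ top e
  IsEndpoint⇒level w∈e = Data.Sum.map (cong level) (cong level) (IsEndpoint⇒lower⊎upper w∈e)

  Crosses-level : ∀ e l → bottom e < lev l → lev l < top e → Crosses ℝ H e l
  Crosses-level e l b<l l<t with lower e | upper e | ends e | lev-<-reflects b<l | lev-<-reflects l<t
  ... | _ | _ | inj₁ (refl , refl) | lo<l | l<up = inj₁ (lo<l , l<up)
  ... | _ | _ | inj₂ (refl , refl) | lo<l | l<up = inj₂ (lo<l , l<up)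

  OnEdge⇔OnSeg : ∀ pos e p → (OnEdge ℝ H pos e p → OnSeg ℝ (pos (lower e)) (pos (upper e)) p)
                            × (OnSeg ℝ (pos (lower e)) (pos (upper e)) p → OnEdge ℝ H pos e p)
  OnEdge⇔OnSeg pos e p with lower e | upper e | ends e
  ... | _ | _ | inj₁ (refl , refl) = id , id
  ... | _ | _ | inj₂ (refl , refl) = OnSeg-sym _ _ p , OnSeg-sym _ _ p

  κ : Fin m → Carrier
  κ e = recip (top e - bottom e) (λ x → <⇒≢ (<⇒0<- (rising e)) (sym x))

  κ-inv : ∀ e → (top e - bottom e) * κ e ≡ 1#
  κ-inv e = *-recip _ _

  edgeAt : Positions ℝ H → Fin m → Carrier → Point ℝ
  edgeAt pos e = segmentAt (pos (lower e)) (pos (upper e)) (bottom e) (κ e)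

  edgeAt-bottom : ∀ pos e → edgeAt pos e (bottom e) ≡ pos (lower e)
  edgeAt-bottom pos e = segmentAt-start _ _ _ _

  edgeGap : Positions ℝ H → Fin m → Fin m → Carrier → Carrier
  edgeGap pos e e' y = abscissa (edgeAt pos e y) - abscissa (edgeAt pos e' y)

  edgeGap-lerp : ∀ pos e e' y₁ y₂ s →
                 edgeGap pos e e' (lerp y₁ y₂ s) ≡ lerp (edgeGap pos e e' y₁) (edgeGap pos e e' y₂) s
  edgeGap-lerp pos e e' y₁ y₂ s =
    trans (cong₂ (λ a b → a - b) (abscissa-segmentAt-lerp _ _ _ _ y₁ y₂ s) (abscissa-segmentAt-lerp _ _ _ _ y₁ y₂ s))
          (lerp-sub _ _ _ _ s)

  module _ {pos : Positions ℝ H} (ld : IsLevelDrawing ℝ H pos) (e : Fin m) where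
    private
      module S = Segment (ld (lower e)) (ld (upper e)) (rising e) (κ-inv e)

    height-edgeAt : ∀ y → height (edgeAt pos e y) ≡ y
    height-edgeAt = S.height-at

    edgeAt-top : edgeAt pos e (top e) ≡ pos (upper e)
    edgeAt-top = S.at-end

    OnEdge⇒≡edgeAt : ∀ p → OnEdge ℝ H pos e p → p ≡ edgeAt pos e (height p)
    OnEdge⇒≡edgeAt p on = S.OnSeg⇒≡at p (proj₁ (OnEdge⇔OnSeg pos e p) on)

    OnEdge⇒Spans : ∀ p → OnEdge ℝ H pos e p → Spans e (height p)
    OnEdge⇒Spans p on = S.OnSeg⇒height-between p (proj₁ (OnEdge⇔OnSeg pos e p) on)

    edgeAt-OnEdge : ∀ y → Spans e y → OnEdge ℝ H pos e (edgeAt pos e y)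
    edgeAt-OnEdge y (b≤y , y≤t) = proj₂ (OnEdge⇔OnSeg pos e _) (S.at-OnSeg y b≤y y≤t)

    edgeAt-endpoint : ∀ w → IsEndpoint ℝ H w e → edgeAt pos e (level w) ≡ pos w
    edgeAt-endpoint w w-end with IsEndpoint⇒lower⊎upper w-end
    ... | inj₁ refl = edgeAt-bottom pos e
    ... | inj₂ refl = S.at-end

module LinearMorph (ℝ : RealField) (H : HierGraph ℝ) (Γ₁ Γ₂ : Positions ℝ H)
                   (ld₁ : IsLevelDrawing ℝ H Γ₁) (ld₂ : IsLevelDrawing ℝ H Γ₂)
                   (ltr : LeftToRightEquivalent ℝ H Γ₁ Γ₂) where
  open RealField ℝ
  open RealFieldProperties ℝ
  open HierGraph H
  open LevelGeometry ℝ H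

  Γ : Carrier → Positions ℝ H
  Γ = morphAt ℝ H Γ₁ Γ₂

  ld : ∀ t → IsLevelDrawing ℝ H (Γ t)
  ld t v = trans (dot-morph (Γ₁ v) (Γ₂ v) t dir)
                 (trans (cong₂ (λ a b → lerp a b t) (ld₁ v) (ld₂ v)) (lerp-const (level v) t))

  record Tracked (l : Fin k) : Set where
    field
      item   : Item ℝ H
      point  : Positions ℝ H → Point ℝ
      meets  : ∀ {pos} → IsLevelDrawing ℝ H pos → Meets ℝ H pos l item (point pos)
      unique : ∀ {pos} → IsLevelDrawing ℝ H pos → ∀ q → Meets ℝ H pos l item q → q ≡ point pos
      abscissa-morph : ∀ t → abscissa (point (Γ t)) ≡ lerp (abscissa (point Γ₁)) (abscissa (point Γ₂)) t

    height-point : ∀ {pos} → IsLevelDrawing ℝ H pos → height (point pos) ≡ lev l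
    height-point {pos} ld-pos with item | meets ld-pos
    ... | inj₁ v | refl , p≡ = trans (cong height p≡) (ld-pos v)
    ... | inj₂ e | _ , _ , h≡ = h≡

  open Tracked

  vertex : ∀ v {l} → γ v ≡ l → Tracked l
  vertex v γv≡l = record
    { item = inj₁ v ; point = λ pos → pos v ; meets = λ _ → γv≡l , refl
    ; unique = λ _ _ → proj₂ ; abscissa-morph = λ t → dot-morph (Γ₁ v) (Γ₂ v) t _ }

  -- An edge meets a line it spans at its crossing point or, on the lines of its
  -- end vertices, at that vertex.
  edge : ∀ e l → Spans e (lev l) → Tracked l
  edge e l sp = record
    { item = item′ sp ; point = λ pos → edgeAt pos e (lev l) ; meets = meets′ sp ; unique = unique′ sp
    ; abscissa-morph = abscissa-segmentAt-morph _ _ _ _ (bottom e) (κ e) (lev l) }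
    where
    item′ : Spans e (lev l) → Item ℝ H
    item′ (inj₂ _ , _)      = inj₁ (lower e)
    item′ (inj₁ _ , inj₂ _) = inj₁ (upper e)
    item′ (inj₁ _ , inj₁ _) = inj₂ e

    at-lower : ∀ pos → bottom e ≡ lev l → edgeAt pos e (lev l) ≡ pos (lower e)
    at-lower pos b≡l = trans (cong (edgeAt pos e) (sym b≡l)) (edgeAt-bottom pos e)

    at-upper : ∀ {pos} → IsLevelDrawing ℝ H pos → lev l ≡ top e → edgeAt pos e (lev l) ≡ pos (upper e)
    at-upper {pos} ld-pos l≡t = trans (cong (edgeAt pos e) l≡t) (edgeAt-top ld-pos e)

    meets′ : ∀ sp {pos} → IsLevelDrawing ℝ H pos → Meets ℝ H pos l (item′ sp) (edgeAt pos e (lev l))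
    meets′ (inj₂ b≡l , _) {pos} _            = lev-injective b≡l , at-lower pos b≡l
    meets′ (inj₁ _ , inj₂ l≡t) ld-pos        = lev-injective (sym l≡t) , at-upper ld-pos l≡t
    meets′ sp@(inj₁ b<l , inj₁ l<t) ld-pos   =
      Crosses-level e l b<l l<t , edgeAt-OnEdge ld-pos e (lev l) sp , height-edgeAt ld-pos e (lev l)

    unique′ : ∀ sp {pos} → IsLevelDrawing ℝ H pos → ∀ q → Meets ℝ H pos l (item′ sp) q → q ≡ edgeAt pos e (lev l)
    unique′ (inj₂ b≡l , _) {pos} _ q (_ , q≡)          = trans q≡ (sym (at-lower pos b≡l))
    unique′ (inj₁ _ , inj₂ l≡t) ld-pos q (_ , q≡)      = trans q≡ (sym (at-upper ld-pos l≡t))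
    unique′ (inj₁ _ , inj₁ _) {pos} ld-pos q (_ , on , h≡) =
      trans (OnEdge⇒≡edgeAt ld-pos e q on) (cong (edgeAt pos e) h≡)

  ordered-transfer : ∀ {l} (C D : Tracked l) {pos pos'} → IsLevelDrawing ℝ H pos → IsLevelDrawing ℝ H pos' →
                     (Precedes ℝ H pos l (item C) (item D) → Precedes ℝ H pos' l (item C) (item D)) →
                     abscissa (point C pos) < abscissa (point D pos) → abscissa (point C pos') < abscissa (point D pos')
  ordered-transfer C D {pos} ld-pos ld-pos' transfer C<D
    with transfer (point C pos , point D pos , meets C ld-pos , meets D ld-pos , C<D)
  ... | p , q , m-p , m-q , p<q = subst₂ _<_ (cong abscissa (unique C ld-pos' p m-p))
                                             (cong abscissa (unique D ld-pos' q m-q)) p<q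

  module _ {l : Fin k} (C D : Tracked l) where

    gap : Positions ℝ H → Carrier
    gap pos = abscissa (point C pos) - abscissa (point D pos)

    private
      strict-transfer : ∀ {pos pos'} → IsLevelDrawing ℝ H pos → IsLevelDrawing ℝ H pos' →
                        (∀ x y → Precedes ℝ H pos l x y → Precedes ℝ H pos' l x y) →
                        ∀ σ → σ ≢ null → HasSign (gap pos) σ → HasSign (gap pos') σ
      strict-transfer ld-pos ld-pos' transfer negative _ g<0 =
        <⇒-<0 (ordered-transfer C D ld-pos ld-pos' (transfer _ _) (-<0⇒< g<0))
      strict-transfer _ _ _ null σ≢null _ = ⊥-elim (σ≢null refl)
      strict-transfer ld-pos ld-pos' transfer positive _ 0<g =
        <⇒0<- (ordered-transfer D C ld-pos ld-pos' (transfer _ _) (0<-⇒< 0<g))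

      forward : ∀ x y → Precedes ℝ H Γ₁ l x y → Precedes ℝ H Γ₂ l x y
      forward x y = proj₁ (ltr l x y)

      backward : ∀ x y → Precedes ℝ H Γ₂ l x y → Precedes ℝ H Γ₁ l x y
      backward x y = proj₂ (ltr l x y)

    gap-sign-Γ₂ : ∀ σ → HasSign (gap Γ₁) σ → HasSign (gap Γ₂) σ
    gap-sign-Γ₂ negative h = strict-transfer ld₁ ld₂ forward negative (λ ()) h
    gap-sign-Γ₂ positive h = strict-transfer ld₁ ld₂ forward positive (λ ()) h
    gap-sign-Γ₂ null g≡0 with sign (gap Γ₂)
    ... | null , h     = h
    ... | negative , h = ⊥-elim (<⇒≢ (strict-transfer ld₂ ld₁ backward negative (λ ()) h) g≡0)
    ... | positive , h = ⊥-elim (<⇒≢ (strict-transfer ld₂ ld₁ backward positive (λ ()) h) (sym g≡0))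

    gap-Γ : ∀ t → gap (Γ t) ≡ lerp (gap Γ₁) (gap Γ₂) t
    gap-Γ t = trans (cong₂ (λ a b → a - b) (abscissa-morph C t) (abscissa-morph D t)) (lerp-sub _ _ _ _ t)

    module _ {t : Carrier} (0≤t : 0# ≤ t) (t≤1 : t ≤ 1#) where

      gap-sign-Γ : ∀ σ → HasSign (gap Γ₁) σ → HasSign (gap (Γ t)) σ
      gap-sign-Γ σ h = subst (λ g → HasSign g σ) (sym (gap-Γ t)) (HasSign-lerp σ 0≤t t≤1 h (gap-sign-Γ₂ σ h))

      gap-sign-reflect : ∀ σ → HasSign (gap (Γ t)) σ → HasSign (gap Γ₁) σ
      gap-sign-reflect σ h with sign (gap Γ₁)
      ... | τ , h₁ = subst (HasSign (gap Γ₁)) (HasSign-unique τ σ (gap-sign-Γ τ h₁) h) h₁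

      coincide-reflect : point C (Γ t) ≡ point D (Γ t) → point C Γ₁ ≡ point D Γ₁
      coincide-reflect eq = height-abscissa-injective _ _
        (trans (height-point C ld₁) (sym (height-point D ld₁)))
        (-≡0⇒≡ (gap-sign-reflect null (≡⇒-≡0 (cong abscissa eq))))

  module _ (pl₁ : IsPlanar ℝ H Γ₁) where

    Γ₁-edges-meet-at-endpoint : ∀ {e e' y} → e ≢ e' → Spans e y → Spans e' y → edgeAt Γ₁ e y ≡ edgeAt Γ₁ e' y →
                                Σ (Fin n) λ w → IsEndpoint ℝ H w e × IsEndpoint ℝ H w e' × level w ≡ y
    Γ₁-edges-meet-at-endpoint {e} {e'} {y} e≢e' sp sp' eq =
      let (w , w∈e , w∈e' , p≡) = proj₂ (proj₂ pl₁) e e' e≢e' _ (edgeAt-OnEdge ld₁ e y sp)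
                                    (subst (OnEdge ℝ H Γ₁ e') (sym eq) (edgeAt-OnEdge ld₁ e' y sp'))
      in w , w∈e , w∈e' , trans (sym (ld₁ w)) (trans (cong height (sym p≡)) (height-edgeAt ld₁ e y))

    module _ {t : Carrier} (0≤t : 0# ≤ t) (t≤1 : t ≤ 1#) where

      Γ-injective : ∀ u v → Γ t u ≡ Γ t v → u ≡ v
      Γ-injective u v eq = proj₁ pl₁ u v (coincide-reflect (vertex u refl) (vertex v (sym γu≡γv)) 0≤t t≤1 eq)
        where γu≡γv : γ u ≡ γ v
              γu≡γv = lev-injective (trans (sym (ld t u)) (trans (cong height eq) (ld t v)))

      Γ-vertex-off-edges : ∀ e w → ¬ IsEndpoint ℝ H w e → ¬ OnEdge ℝ H (Γ t) e (Γ t w)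
      Γ-vertex-off-edges e w w∉e on =
        proj₁ (proj₂ pl₁) e w w∉e (subst (OnEdge ℝ H Γ₁ e) (sym Γ₁w≡) (edgeAt-OnEdge ld₁ e (level w) spans))
        where
        spans : Spans e (level w)
        spans = subst (Spans e) (ld t w) (OnEdge⇒Spans (ld t) e _ on)
        Γ₁w≡ : Γ₁ w ≡ edgeAt Γ₁ e (level w)
        Γ₁w≡ = coincide-reflect (vertex w refl) (edge e (γ w) spans) 0≤t t≤1
                 (trans (OnEdge⇒≡edgeAt (ld t) e _ on) (cong (edgeAt (Γ t) e) (ld t w)))

      meet-on-line : ∀ {e e'} → e ≢ e' → ∀ l → Spans e (lev l) → Spans e' (lev l) →
                     edgeAt (Γ t) e (lev l) ≡ edgeAt (Γ t) e' (lev l) →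
                     Σ (Fin n) λ w → IsEndpoint ℝ H w e × IsEndpoint ℝ H w e' × edgeAt (Γ t) e (lev l) ≡ Γ t w
      meet-on-line {e} {e'} e≢e' l sp sp' eq =
        let (w , w∈e , w∈e' , level≡) = Γ₁-edges-meet-at-endpoint e≢e' sp sp'
                                          (coincide-reflect (edge e l sp) (edge e' l sp') 0≤t t≤1 eq)
        in w , w∈e , w∈e' , trans (cong (edgeAt (Γ t) e) (sym level≡)) (edgeAt-endpoint (ld t) e w w∈e)

      no-meet-between : ∀ {e e'} → e ≢ e' → ∀ {l₁ l₂} →
                        Spans e (lev l₁) → Spans e' (lev l₁) → Spans e (lev l₂) → Spans e' (lev l₂) →
                        ∀ {y} → lev l₁ < y → y < lev l₂ → edgeAt (Γ t) e y ≡ edgeAt (Γ t) e' y → ⊥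
      no-meet-between {e} {e'} e≢e' {l₁} {l₂} sp₁ sp₁' sp₂ sp₂' {y} L₁<y y<L₂ eq =
        let (s , 0<s , s<1 , y≡) = lerp-onto L₁<y y<L₂
            (σ₁ , sign₁) = sign (edgeGap Γ₁ e e' L₁)
            (σ₂ , sign₂) = sign (edgeGap Γ₁ e e' L₂)
            (r , 0<r , r<1 , root) = lerp-root-by-signs σ₁ σ₂
              (gap-sign-Γ (edge e l₁ sp₁) (edge e' l₁ sp₁') 0≤t t≤1 σ₁ sign₁) sign₁
              (gap-sign-Γ (edge e l₂ sp₂) (edge e' l₂ sp₂') 0≤t t≤1 σ₂ sign₂) sign₂
              0<s s<1
              (trans (sym (edgeGap-lerp (Γ t) e e' L₁ L₂ s))
                     (trans (cong (edgeGap (Γ t) e e') y≡) (≡⇒-≡0 (cong abscissa eq))))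
            (L₁<z , z<L₂) = lerp-strict 0<r r<1 (<-trans _ _ _ L₁<y y<L₂)
            spans : ∀ {f} → Spans f L₁ → Spans f L₂ → Spans f (lerp L₁ L₂ r)
            spans = λ sp sp' → ≤-trans (proj₁ sp) (inj₁ L₁<z) , ≤-trans (inj₁ z<L₂) (proj₂ sp')
            (w , w∈e , _ , level≡z) = Γ₁-edges-meet-at-endpoint e≢e' (spans sp₁ sp₂) (spans sp₁' sp₂')
              (height-abscissa-injective _ _
                (trans (height-edgeAt ld₁ e _) (sym (height-edgeAt ld₁ e' _)))
                (-≡0⇒≡ (trans (edgeGap-lerp Γ₁ e e' L₁ L₂ r) root)))
        in [ (λ w-bottom → <⇒≱ L₁<z (subst (_≤ L₁) (trans (sym w-bottom) level≡z) (proj₁ sp₁)))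
           , (λ w-top    → <⇒≱ z<L₂ (subst (L₂ ≤_) (trans (sym w-top) level≡z) (proj₂ sp₂))) ]
           (IsEndpoint⇒level w∈e)
        where
        L₁ = lev l₁
        L₂ = lev l₂

      meet-in-range : ∀ {e e'} → e ≢ e' → ∀ {l₁ l₂} →
                      Spans e (lev l₁) → Spans e' (lev l₁) → Spans e (lev l₂) → Spans e' (lev l₂) →
                      ∀ {y} → lev l₁ ≤ y → y ≤ lev l₂ → edgeAt (Γ t) e y ≡ edgeAt (Γ t) e' y →
                      Σ (Fin n) λ w → IsEndpoint ℝ H w e × IsEndpoint ℝ H w e' × edgeAt (Γ t) e y ≡ Γ t w
      meet-in-range e≢e' {l₁} sp₁ sp₁' _ _ (inj₂ refl) _ eq = meet-on-line e≢e' l₁ sp₁ sp₁' eq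
      meet-in-range e≢e' {l₂ = l₂} _ _ sp₂ sp₂' (inj₁ _) (inj₂ refl) eq = meet-on-line e≢e' l₂ sp₂ sp₂' eq
      meet-in-range e≢e' sp₁ sp₁' sp₂ sp₂' (inj₁ L₁<y) (inj₁ y<L₂) eq =
        ⊥-elim (no-meet-between e≢e' sp₁ sp₁' sp₂ sp₂' L₁<y y<L₂ eq)

      Γ-edges-meet-at-endpoints : ∀ e e' → e ≢ e' → ∀ p → OnEdge ℝ H (Γ t) e p → OnEdge ℝ H (Γ t) e' p →
                                  Σ (Fin n) λ w → IsEndpoint ℝ H w e × IsEndpoint ℝ H w e' × p ≡ Γ t w
      Γ-edges-meet-at-endpoints e e' e≢e' p on on' =
        let (b≤y , y≤t) = OnEdge⇒Spans (ld t) e p on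
            (b'≤y , y≤t') = OnEdge⇒Spans (ld t) e' p on'
            (u₁ , b≤L₁ , b'≤L₁ , L₁-least) = max-attained level (lower e) (lower e')
            (u₂ , L₂≤t , L₂≤t' , L₂-greatest) = min-attained level (upper e) (upper e')
            L₁≤y = L₁-least b≤y b'≤y
            y≤L₂ = L₂-greatest y≤t y≤t'
            (w , w∈e , w∈e' , at≡) = meet-in-range e≢e' {γ u₁} {γ u₂}
              (b≤L₁ , ≤-trans L₁≤y y≤t) (b'≤L₁ , ≤-trans L₁≤y y≤t')
              (≤-trans b≤y y≤L₂ , L₂≤t) (≤-trans b'≤y y≤L₂ , L₂≤t')
              L₁≤y y≤L₂ (trans (sym p≡) (OnEdge⇒≡edgeAt (ld t) e' p on'))
        in w , w∈e , w∈e' , trans p≡ at≡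
        where p≡ = OnEdge⇒≡edgeAt (ld t) e p on

      Γ-planar : IsPlanar ℝ H (Γ t)
      Γ-planar = Γ-injective , Γ-vertex-off-edges , Γ-edges-meet-at-endpoints

  unidirectional : IsUnidirectional ℝ H Γ₁ Γ₂
  unidirectional = lineDir ℝ H , lineDir≢origin ,
    λ v → _ , height≡0⇒∥lineDir _ (trans (dot-⊖ (Γ₂ v) (Γ₁ v) dir)
                                         (trans (cong₂ (λ a b → a - b) (ld₂ v) (ld₁ v)) (-‿inverseʳ _)))

lemma6 : (ℝ : RealField) (H : HierGraph ℝ) (Γ₁ Γ₂ : Positions ℝ H) →
         IsLevelPlanarDrawing ℝ H Γ₁ → IsLevelPlanarDrawing ℝ H Γ₂ →
         LeftToRightEquivalent ℝ H Γ₁ Γ₂ →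
         IsPlanarMorph ℝ H Γ₁ Γ₂ × IsUnidirectional ℝ H Γ₁ Γ₂
lemma6 ℝ H Γ₁ Γ₂ (ld₁ , planar₁) (ld₂ , _) ltr = (λ t 0≤t t≤1 → Γ-planar planar₁ 0≤t t≤1) , unidirectional
  where open LinearMorph ℝ H Γ₁ Γ₂ ld₁ ld₂ ltr
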